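{- Let $G$ be a graph and let $e=uv$ be a bridge of $G$ that is non-trivial, i.e. $G-e$ consists of two parts $G_1$ (containing $u$) and $G_2$ (containing $v$), each having at least two vertices. Then $\chi_o(G)\le \max\{3,\chi_o(G_1),\chi_o(G_2)\}$.
   Context: All graphs are finite, simple and undirected. A proper vertex coloring $\varphi$ of a graph $G$ is called an odd coloring if for every non-isolated vertex $x$ of $G$ there is a color $c$ such that the number of neighbors $y\in N(x)$ with $\varphi(y)=c$ is odd. The odd chromatic number $\chi_o(G)$ is the minimum number of colors in an odd coloring of $G$. -}

module Defs where

open import Data.Bool using (Bool; true; false; _∧_; if_then_else_)
open import Data.Nat using (ℕ; zero; suc; _+_; _<_; _≤_; _%_)
open import Data.Fin using (Fin; _≟_)
import Data.Fin as F
open import Data.Sum using (_⊎_)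
open import Data.Product using (Σ; ∃; _×_; _,_)
open import Relation.Binary.PropositionalEquality using (_≡_; _≢_)
open import Relation.Nullary using (¬_)
open import Relation.Nullary.Decidable using (⌊_⌋)

record Graph (n : ℕ) : Set where
  field
    adj   : Fin n → Fin n → Bool
    sym   : ∀ x y → adj x y ≡ adj y x
    irrefl : ∀ x → adj x x ≡ false
open Graph public

count : ∀ {n} → (Fin n → Bool) → ℕ
count {zero}  p = 0
count {suc n} p = (if p F.zero then 1 else 0) + count (λ i → p (F.suc i))

Odd : ℕ → Set
Odd m = m % 2 ≡ 1

-- Vertex subsets of Fin n as Boolean predicates;
-- G [ S ] denotes the induced subgraph on S (we work with G and S directly).
Subset : ℕ → Set
Subset n = Fin n → Bool

all : ∀ {n} → Subset n
all _ = true

_∈_ : ∀ {n} → Fin n → Subset n → Set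
x ∈ S = S x ≡ true

nbrsColoured : ∀ {n k} → Graph n → Subset n → (Fin n → Fin k) → Fin n → Fin k → ℕ
nbrsColoured G S φ x c = count (λ y → S y ∧ adj G x y ∧ ⌊ φ y ≟ c ⌋)

NonIsolatedIn : ∀ {n} → Graph n → Subset n → Fin n → Set
NonIsolatedIn G S x = ∃ λ y → y ∈ S × adj G x y ≡ true

IsOddColoringOn : ∀ {n k} → Graph n → Subset n → (Fin n → Fin k) → Set
IsOddColoringOn G S φ =
  (∀ x y → x ∈ S → y ∈ S → adj G x y ≡ true → φ x ≢ φ y)
  × (∀ x → x ∈ S → NonIsolatedIn G S x → ∃ λ c → Odd (nbrsColoured G S φ x c))

OddColorableOn : ∀ {n} → Graph n → Subset n → ℕ → Set
OddColorableOn {n} G S k = ∃ λ (φ : Fin n → Fin k) → IsOddColoringOn G S φ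

IsOddChromaticNumberOn : ∀ {n} → Graph n → Subset n → ℕ → Set
IsOddChromaticNumberOn G S k =
  OddColorableOn G S k × (∀ j → j < k → ¬ OddColorableOn G S j)

IsOddChromaticNumber : ∀ {n} → Graph n → ℕ → Set
IsOddChromaticNumber G k = IsOddChromaticNumberOn G all k

-- y is reachable from x by a walk in G[S] (x ∈ S assumed separately)
data ReachIn {n} (G : Graph n) (S : Subset n) (x : Fin n) : Fin n → Set where
  here : ReachIn G S x x
  step : ∀ {y z} → ReachIn G S x y → z ∈ S → adj G y z ≡ true → ReachIn G S x z

ConnectedOn : ∀ {n} → Graph n → Subset n → Set
ConnectedOn G S = ∀ x y → x ∈ S → y ∈ S → ReachIn G S x y

AtLeastTwo : ∀ {n} → Subset n → Set
AtLeastTwo S = ∃ λ x → ∃ λ y → x ∈ S × y ∈ S × x ≢ y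

-- e = uv is a non-trivial bridge of G with sides S₁ ∋ u and S₂ ∋ v:
-- S₁, S₂ partition V(G), uv ∈ E(G), uv is the only edge between S₁ and S₂,
-- so G - e consists exactly of the two parts G₁ = G[S₁] and G₂ = G[S₂],
-- which are connected and each have at least two vertices.
record NonTrivialBridge {n} (G : Graph n) (u v : Fin n) (S₁ S₂ : Subset n) : Set where
  field
    partition  : ∀ x → (x ∈ S₁ × S₂ x ≡ false) ⊎ (S₁ x ≡ false × x ∈ S₂)
    u∈S₁       : u ∈ S₁
    v∈S₂       : v ∈ S₂
    uv-edge    : adj G u v ≡ true
    only-cross : ∀ x y → x ∈ S₁ → y ∈ S₂ → adj G x y ≡ true → (x ≡ u × y ≡ v)
    conn₁      : ConnectedOn G S₁
    conn₂      : ConnectedOn G S₂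
    two₁       : AtLeastTwo S₁
    two₂       : AtLeastTwo S₂

{-# OPTIONS --safe #-}
module Submission where

-- Colour G₁ and G₂ oddly with M = max {3, χₒ(G₁), χₒ(G₂)} colours and take the union.
-- As both sides are connected with at least two vertices, every vertex keeps a neighbour
-- on its own side, and adding the bridge uv only changes the neighbourhoods of u and v.
-- Let cᵤ be an odd colour at u in G₁ and cᵥ one at v in G₂; an odd colour never equals
-- the vertex's own colour. Permute the colours of G₂ so that cᵥ becomes cᵤ and v receives
-- a colour a ∉ {φ₁(u), cᵤ}, which exists since M ≥ 3. Then uv is properly coloured, and the
-- bridge adds to u the colour a ≠ cᵤ and to v the colour φ₁(u) ≠ cᵤ, so cᵤ stays odd at both.

open import Defs hiding (sym)
open import Data.Nat using (ℕ; _≤_; _⊔_)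
open import Data.Fin using (Fin)

open import Data.Bool using (Bool; true; false; _∧_; if_then_else_)
open import Data.Nat using (zero; suc; _+_; s≤s)
open import Data.Nat.Properties using (m≤m⊔n; m≤n⊔m; m≤n⇒m≤n⊔o; ≮⇒≥)
open import Data.Fin using (_≟_; inject≤)
open import Data.Fin.Patterns using (0F; 1F; 2F)
open import Data.Fin.Properties using (inject≤-injective)
open import Data.Fin.Permutation using (Permutation′; _⟨$⟩ʳ_; _⟨$⟩ˡ_; inverseˡ; transpose; _∘ₚ_)
open import Data.Product using (∃; _×_; _,_; proj₁; proj₂; map₂)
open import Data.Sum using (_⊎_; inj₁; inj₂)
import Data.Sum as Sum
import Data.Product as Prod
open import Function using (_∘_)
open import Function.Definitions using (Injective)
open import Relation.Nullary using (¬_; yes; no; Dec; contradiction)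
open import Relation.Nullary.Decidable using (⌊_⌋; isYes≗does; dec-true; dec-false)
open import Relation.Binary.PropositionalEquality using (_≡_; _≢_; refl; sym; trans; cong; cong₂; subst; _≗_)

private
  variable
    n m k : ℕ

count-cong : {p q : Fin n → Bool} → p ≗ q → count p ≡ count q
count-cong {zero}  p≗q = refl
count-cong {suc n} p≗q =
  cong₂ _+_ (cong (if_then 1 else 0) (p≗q 0F)) (count-cong (p≗q ∘ Fin.suc))

count-false : count {n} (λ _ → false) ≡ 0
count-false {zero}  = refl
count-false {suc n} = count-false {n}

⌊⌋-false : ∀ {a} {A : Set a} (a? : Dec A) → ¬ A → ⌊ a? ⌋ ≡ false
⌊⌋-false a? ¬a = trans (isYes≗does a?) (dec-false a? ¬a)

⌊≟⌋-injective : {h : Fin k → Fin m} → Injective _≡_ _≡_ h →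
                ∀ a b → ⌊ h a ≟ h b ⌋ ≡ ⌊ a ≟ b ⌋
⌊≟⌋-injective {h = h} inj a b with a ≟ b | h a ≟ h b
... | yes _    | yes _  = refl
... | yes refl | no ¬q  = contradiction refl ¬q
... | no ¬p    | yes q  = contradiction (inj q) ¬p
... | no _     | no _   = refl

ProperColoringOn : Graph n → Subset n → (Fin n → Fin k) → Set
ProperColoringOn G S φ = ∀ x y → x ∈ S → y ∈ S → adj G x y ≡ true → φ x ≢ φ y

module _ {n} (G : Graph n) (S : Subset n) where

  nbrsColoured-cong : {φ ψ : Fin n → Fin k} → φ ≗ ψ →
                      ∀ x c → nbrsColoured G S φ x c ≡ nbrsColoured G S ψ x c
  nbrsColoured-cong φ≗ψ x c =
    count-cong λ y → cong (λ d → S y ∧ adj G x y ∧ ⌊ d ≟ c ⌋) (φ≗ψ y)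

  nbrsColoured-∘-injective : (φ : Fin n → Fin k) {h : Fin k → Fin m} →
                             Injective _≡_ _≡_ h → ∀ x c →
                             nbrsColoured G S (h ∘ φ) x (h c) ≡ nbrsColoured G S φ x c
  nbrsColoured-∘-injective φ inj x c =
    count-cong λ y → cong (λ b → S y ∧ adj G x y ∧ b) (⌊≟⌋-injective inj (φ y) c)

  odd-∘-injective : (φ : Fin n → Fin k) {h : Fin k → Fin m} → Injective _≡_ _≡_ h →
                    ∀ {x c} → Odd (nbrsColoured G S φ x c) → Odd (nbrsColoured G S (h ∘ φ) x (h c))
  odd-∘-injective φ inj {x} {c} = subst Odd (sym (nbrsColoured-∘-injective φ inj x c))

  isOddColoringOn-∘-injective : {φ : Fin n → Fin k} {h : Fin k → Fin m} →
                                Injective _≡_ _≡_ h →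
                                IsOddColoringOn G S φ → IsOddColoringOn G S (h ∘ φ)
  isOddColoringOn-∘-injective {φ = φ} {h} inj (proper , odd) =
      (λ x y x∈S y∈S xy → proper x y x∈S y∈S xy ∘ inj)
    , λ x x∈S x-nonIsolated →
        let c , oddAtC = odd x x∈S x-nonIsolated in h c , odd-∘-injective φ inj oddAtC

  oddColorableOn-≤ : k ≤ m → OddColorableOn G S k → OddColorableOn G S m
  oddColorableOn-≤ k≤m (φ , isOdd) =
    (λ x → inject≤ (φ x) k≤m) ,
    isOddColoringOn-∘-injective (inject≤-injective k≤m k≤m _ _) isOdd

  nbrsColoured-own-colour : {φ : Fin n → Fin k} → ProperColoringOn G S φ →
                            ∀ {x} → x ∈ S → nbrsColoured G S φ x (φ x) ≡ 0
  nbrsColoured-own-colour {φ = φ} proper {x} x∈S =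
    trans (count-cong noNeighbourOfOwnColour) (count-false {n})
    where
    noNeighbourOfOwnColour : ∀ y → (S y ∧ adj G x y ∧ ⌊ φ y ≟ φ x ⌋) ≡ false
    noNeighbourOfOwnColour y with S y in y∈S | adj G x y in xy
    ... | false | _     = refl
    ... | true  | false = refl
    ... | true  | true  = ⌊⌋-false (φ y ≟ φ x) (proper x y x∈S y∈S xy ∘ sym)

  odd-colour≢own-colour : {φ : Fin n → Fin k} → ProperColoringOn G S φ →
                          ∀ {x c} → x ∈ S → Odd (nbrsColoured G S φ x c) → c ≢ φ x
  odd-colour≢own-colour proper x∈S oddAtC refl
    with () ← subst Odd (nbrsColoured-own-colour proper x∈S) oddAtC

  reach⇒nonIsolated : ∀ {x z} → ReachIn G S x z → x ≢ z → NonIsolatedIn G S x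
  reach⇒nonIsolated here x≢x = contradiction refl x≢x
  reach⇒nonIsolated {x} (step {y} x⇝y z∈S yz) _ with x ≟ y
  ... | yes refl = _ , z∈S , yz
  ... | no x≢y   = reach⇒nonIsolated x⇝y x≢y

  connected⇒nonIsolated : ConnectedOn G S → AtLeastTwo S →
                          ∀ x → x ∈ S → NonIsolatedIn G S x
  connected⇒nonIsolated conn (y , z , y∈S , z∈S , y≢z) x x∈S with x ≟ y
  ... | yes refl = reach⇒nonIsolated (conn x z x∈S z∈S) y≢z
  ... | no x≢y   = reach⇒nonIsolated (conn x y x∈S y∈S) x≢y

permutation-injective : (π : Permutation′ m) → Injective _≡_ _≡_ (π ⟨$⟩ʳ_)
permutation-injective π πx≡πy =
  trans (sym (inverseˡ π)) (trans (cong (π ⟨$⟩ˡ_) πx≡πy) (inverseˡ π))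

transpose-matchˡ : (i j : Fin m) → transpose i j ⟨$⟩ʳ i ≡ j
transpose-matchˡ i j rewrite dec-true (i ≟ i) refl = refl

transpose-fix : {i j l : Fin m} → l ≢ i → l ≢ j → transpose i j ⟨$⟩ʳ l ≡ l
transpose-fix {i = i} {j} {l} l≢i l≢j
  rewrite dec-false (l ≟ i) l≢i | dec-false (l ≟ j) l≢j = refl

permutation-sending : {x x′ y y′ : Fin m} → x ≢ x′ → y ≢ y′ →
                      ∃ λ (π : Permutation′ m) → π ⟨$⟩ʳ x ≡ y × π ⟨$⟩ʳ x′ ≡ y′
permutation-sending {x = x} {x′} {y} {y′} x≢x′ y≢y′ =
  τ ∘ₚ σ , πx≡y , transpose-matchˡ d y′
  where
  τ = transpose x y
  d = τ ⟨$⟩ʳ x′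
  σ = transpose d y′
  y≢d : y ≢ d
  y≢d y≡d = x≢x′ (permutation-injective τ (trans (transpose-matchˡ x y) y≡d))
  πx≡y : σ ⟨$⟩ʳ (τ ⟨$⟩ʳ x) ≡ y
  πx≡y rewrite transpose-matchˡ x y = transpose-fix y≢d y≢y′

fresh-colour : 3 ≤ m → (p q : Fin m) → ∃ λ a → a ≢ p × a ≢ q
fresh-colour (s≤s (s≤s (s≤s _))) 0F                    0F                    = 1F , (λ ()) , (λ ())
fresh-colour (s≤s (s≤s (s≤s _))) 0F                    1F                    = 2F , (λ ()) , (λ ())
fresh-colour (s≤s (s≤s (s≤s _))) 0F                    (Fin.suc (Fin.suc _)) = 1F , (λ ()) , (λ ())
fresh-colour (s≤s (s≤s (s≤s _))) 1F                    0F                    = 2F , (λ ()) , (λ ())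
fresh-colour (s≤s (s≤s (s≤s _))) 1F                    (Fin.suc _)           = 0F , (λ ()) , (λ ())
fresh-colour (s≤s (s≤s (s≤s _))) (Fin.suc (Fin.suc _)) 0F                    = 1F , (λ ()) , (λ ())
fresh-colour (s≤s (s≤s (s≤s _))) (Fin.suc (Fin.suc _)) (Fin.suc _)           = 0F , (λ ()) , (λ ())

glue : Subset n → (Fin n → Fin k) → (Fin n → Fin k) → Fin n → Fin k
glue S ψ₁ ψ₂ x = if S x then ψ₁ x else ψ₂ x

swap-sides : {G : Graph n} {u v : Fin n} {S₁ S₂ : Subset n} →
             NonTrivialBridge G u v S₁ S₂ → NonTrivialBridge G v u S₂ S₁
swap-sides {G = G} {u} {v} B = record
  { partition  = Sum.swap ∘ Sum.map Prod.swap Prod.swap ∘ partition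
  ; u∈S₁       = v∈S₂
  ; v∈S₂       = u∈S₁
  ; uv-edge    = trans (Graph.sym G v u) uv-edge
  ; only-cross = λ x y x∈S₂ y∈S₁ xy →
      let y≡u , x≡v = only-cross y x y∈S₁ x∈S₂ (trans (Graph.sym G y x) xy) in x≡v , y≡u
  ; conn₁      = conn₂
  ; conn₂      = conn₁
  ; two₁       = two₂
  ; two₂       = two₁
  }
  where
  open NonTrivialBridge B

module _ {G : Graph n} {u v : Fin n} {S₁ S₂ : Subset n} (B : NonTrivialBridge G u v S₁ S₂)
         (ψ₁ ψ₂ : Fin n → Fin k) where
  open NonTrivialBridge B

  glue-swap-sides : glue S₂ ψ₂ ψ₁ ≗ glue S₁ ψ₁ ψ₂
  glue-swap-sides x with partition x
  ... | inj₁ (x∈S₁ , x∉S₂) rewrite x∈S₁ | x∉S₂ = refl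
  ... | inj₂ (x∉S₁ , x∈S₂) rewrite x∉S₁ | x∈S₂ = refl

  glue-proper : ProperColoringOn G S₁ ψ₁ → ψ₁ u ≢ ψ₂ v →
                ∀ x y → x ∈ S₁ → adj G x y ≡ true → glue S₁ ψ₁ ψ₂ x ≢ glue S₁ ψ₁ ψ₂ y
  glue-proper proper ψ₁u≢ψ₂v x y x∈S₁ xy rewrite x∈S₁ with partition y
  ... | inj₁ (y∈S₁ , _) rewrite y∈S₁ = proper x y x∈S₁ y∈S₁ xy
  ... | inj₂ (y∉S₁ , y∈S₂) rewrite y∉S₁ with only-cross x y x∈S₁ y∈S₂ xy
  ...   | refl , refl = ψ₁u≢ψ₂v

  -- The only neighbour of x ∈ S₁ outside S₁ is v, when x = u.
  glue-nbrsColoured : ∀ {x c} → x ∈ S₁ → (x ≡ u → ψ₂ v ≢ c) →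
                      nbrsColoured G all (glue S₁ ψ₁ ψ₂) x c ≡ nbrsColoured G S₁ ψ₁ x c
  glue-nbrsColoured {x} {c} x∈S₁ ψ₂v≢c = count-cong sameNeighbours
    where
    sameNeighbours : ∀ y → (adj G x y ∧ ⌊ glue S₁ ψ₁ ψ₂ y ≟ c ⌋)
                         ≡ (S₁ y ∧ adj G x y ∧ ⌊ ψ₁ y ≟ c ⌋)
    sameNeighbours y with partition y
    ... | inj₁ (y∈S₁ , _) rewrite y∈S₁ = refl
    ... | inj₂ (y∉S₁ , y∈S₂) rewrite y∉S₁ with adj G x y in xy
    ...   | false = refl
    ...   | true with only-cross x y x∈S₁ y∈S₂ xy
    ...     | refl , refl = ⌊⌋-false (ψ₂ v ≟ c) (ψ₂v≢c refl)

  glue-odd : IsOddColoringOn G S₁ ψ₁ →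
             (∃ λ c → Odd (nbrsColoured G S₁ ψ₁ u c) × ψ₂ v ≢ c) →
             ∀ x → x ∈ S₁ → ∃ λ c → Odd (nbrsColoured G all (glue S₁ ψ₁ ψ₂) x c)
  glue-odd (_ , odd) (cᵤ , oddAtu , ψ₂v≢cᵤ) x x∈S₁ with x ≟ u
  ... | yes refl = cᵤ , subst Odd (sym (glue-nbrsColoured x∈S₁ λ _ → ψ₂v≢cᵤ)) oddAtu
  ... | no x≢u =
    let c , oddAtx = odd x x∈S₁ (connected⇒nonIsolated G S₁ conn₁ two₁ x x∈S₁)
    in c , subst Odd (sym (glue-nbrsColoured x∈S₁ λ x≡u → contradiction x≡u x≢u)) oddAtx

module _ {G : Graph n} {u v : Fin n} {S₁ S₂ : Subset n} where

  glue-isOddColoring : (B : NonTrivialBridge G u v S₁ S₂) {ψ₁ ψ₂ : Fin n → Fin k} →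
                       IsOddColoringOn G S₁ ψ₁ → IsOddColoringOn G S₂ ψ₂ → ψ₁ u ≢ ψ₂ v →
                       (∃ λ c → Odd (nbrsColoured G S₁ ψ₁ u c) × ψ₂ v ≢ c) →
                       (∃ λ c → Odd (nbrsColoured G S₂ ψ₂ v c) × ψ₁ u ≢ c) →
                       IsOddColoringOn G all (glue S₁ ψ₁ ψ₂)
  glue-isOddColoring B {ψ₁} {ψ₂} col₁ col₂ ψ₁u≢ψ₂v oddAtu oddAtv = proper , odd
    where
    open NonTrivialBridge B
    B′ = swap-sides B
    proper : ProperColoringOn G all (glue S₁ ψ₁ ψ₂)
    proper x y _ _ xy with partition x
    ... | inj₁ (x∈S₁ , _) = glue-proper B ψ₁ ψ₂ (proj₁ col₁) ψ₁u≢ψ₂v x y x∈S₁ xy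
    ... | inj₂ (_ , x∈S₂) = λ φx≡φy →
      glue-proper B′ ψ₂ ψ₁ (proj₁ col₂) (ψ₁u≢ψ₂v ∘ sym) x y x∈S₂ xy
        (trans (glue-swap-sides B ψ₁ ψ₂ x) (trans φx≡φy (sym (glue-swap-sides B ψ₁ ψ₂ y))))
    odd : ∀ x → x ∈ all → NonIsolatedIn G all x →
          ∃ λ c → Odd (nbrsColoured G all (glue S₁ ψ₁ ψ₂) x c)
    odd x _ _ with partition x
    ... | inj₁ (x∈S₁ , _) = glue-odd B ψ₁ ψ₂ col₁ oddAtu x x∈S₁
    ... | inj₂ (_ , x∈S₂) =
      map₂ (λ {c} → subst Odd (nbrsColoured-cong G all (glue-swap-sides B ψ₁ ψ₂) x c))
           (glue-odd B′ ψ₂ ψ₁ col₂ oddAtv x x∈S₂)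

  bridge-oddColorable : NonTrivialBridge G u v S₁ S₂ → 3 ≤ k →
                        OddColorableOn G S₁ k → OddColorableOn G S₂ k → OddColorableOn G all k
  bridge-oddColorable B 3≤k (ψ₁ , col₁) (ψ₂ , col₂) =
    let cᵤ , oddAtu = proj₂ col₁ u u∈S₁ (connected⇒nonIsolated G S₁ conn₁ two₁ u u∈S₁)
        cᵥ , oddAtv = proj₂ col₂ v v∈S₂ (connected⇒nonIsolated G S₂ conn₂ two₂ v v∈S₂)
        cᵤ≢ψ₁u = odd-colour≢own-colour G S₁ (proj₁ col₁) u∈S₁ oddAtu
        cᵥ≢ψ₂v = odd-colour≢own-colour G S₂ (proj₁ col₂) v∈S₂ oddAtv
        a , a≢ψ₁u , a≢cᵤ = fresh-colour 3≤k (ψ₁ u) cᵤ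
        π , πcᵥ≡cᵤ , πψ₂v≡a = permutation-sending cᵥ≢ψ₂v (a≢cᵤ ∘ sym)
        π-inj = permutation-injective π
        πψ₂ = (π ⟨$⟩ʳ_) ∘ ψ₂
    in glue S₁ ψ₁ πψ₂ ,
       glue-isOddColoring B col₁ (isOddColoringOn-∘-injective G S₂ π-inj col₂)
         (a≢ψ₁u ∘ trans (sym πψ₂v≡a) ∘ sym)
         (cᵤ , oddAtu , a≢cᵤ ∘ trans (sym πψ₂v≡a))
         ( cᵤ
         , subst (Odd ∘ nbrsColoured G S₂ πψ₂ v) πcᵥ≡cᵤ (odd-∘-injective G S₂ ψ₂ π-inj oddAtv)
         , cᵤ≢ψ₁u ∘ sym)
    where open NonTrivialBridge B

mainTheorem2 : ∀ {n} (G : Graph n) (u v : Fin n) (S₁ S₂ : Subset n)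
    → NonTrivialBridge G u v S₁ S₂
    → ∀ k k₁ k₂
    → IsOddChromaticNumber G k
    → IsOddChromaticNumberOn G S₁ k₁
    → IsOddChromaticNumberOn G S₂ k₂
    → k ≤ 3 ⊔ k₁ ⊔ k₂
mainTheorem2 G u v S₁ S₂ B k k₁ k₂ (_ , minimal) (colorable₁ , _) (colorable₂ , _) =
  ≮⇒≥ λ M<k → minimal _ M<k
    (bridge-oddColorable B 3≤M
      (oddColorableOn-≤ G S₁ k₁≤M colorable₁)
      (oddColorableOn-≤ G S₂ k₂≤M colorable₂))
  where
  3≤M : 3 ≤ 3 ⊔ k₁ ⊔ k₂
  3≤M = m≤n⇒m≤n⊔o k₂ (m≤m⊔n 3 k₁)
  k₁≤M : k₁ ≤ 3 ⊔ k₁ ⊔ k₂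
  k₁≤M = m≤n⇒m≤n⊔o k₂ (m≤n⊔m 3 k₁)
  k₂≤M : k₂ ≤ 3 ⊔ k₁ ⊔ k₂
  k₂≤M = m≤n⊔m (3 ⊔ k₁) k₂
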